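{- For integers $t \ge 1$, let $N'(t)$ be the number of fault-free tilings of the $4 \times 3t$ rectangle by right trominoes. Then $N'(1)=4$, $N'(2)=2$, and $N'(t) = 8 \cdot 6^{t-3}$ for all $t \ge 3$. Equivalently, with $N'(0)=0$, \[ \sum_{t \ge 0} N'(t)\, z^t = 2z\,\frac{2 - 11 z - 2 z^2}{1 - 6 z}. \]
   Context: A right tromino is the polyomino of three unit squares obtained by deleting one cell from a $2 \times 2$ square. A tiling of a region by a polyomino is a partition of its unit cells into copies of the polyomino, where copies may be translated, rotated and reflected. A $4 \times n$ rectangle has 4 rows and $n$ columns, occupying $[0,n]\times[0,4]$. A tiling of this rectangle is fault-free if there is no integer $k$ with $0<k<n$ such that every tile lies entirely in $x \le k$ or entirely in $x \ge k$. -}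

module Defs where

open import Data.Nat using (ℕ; zero; suc; _+_; _*_; _∸_; _^_; _≤_; _<_)
open import Data.Fin using (Fin; toℕ)
open import Data.Bool using (Bool; true)
open import Data.Product using (Σ; ∃; _×_; _,_)
open import Data.Sum using (_⊎_)
open import Data.List using (List; length)
open import Data.List.Relation.Unary.All using (All)
open import Data.List.Relation.Unary.Any using (Any)
open import Data.List.Relation.Unary.AllPairs using (AllPairs)
open import Relation.Nullary using (¬_)
open import Relation.Binary.PropositionalEquality using (_≡_)

-- The 4 × n rectangle [0,n] × [0,4]: cell (i , j) is the unit square
-- [i,i+1] × [j,j+1], with column i : Fin n and row j : Fin 4.

-- A placed right tromino (a copy under translation/rotation/reflection)
-- is a 2 × 2 block with one cell deleted.  It is given by the lower-left
-- corner (x , y) of the 2 × 2 block (x < n - 1 , y < 3, so the block fits)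
-- and the offset (dx , dy) ∈ {0,1}² of the deleted cell.
Placement : ℕ → Set
Placement n = Fin (n ∸ 1) × Fin 3 × (Fin 2 × Fin 2)

Covers : ∀ {n} → Placement n → Fin n → Fin 4 → Set
Covers (x , y , miss) i j =
  Σ (Fin 2) λ dx → Σ (Fin 2) λ dy →
    (toℕ i ≡ toℕ x + toℕ dx) × (toℕ j ≡ toℕ y + toℕ dy) × ¬ (miss ≡ (dx , dy))

TileSet : ℕ → Set
TileSet n = Placement n → Bool

_≗T_ : ∀ {n} → TileSet n → TileSet n → Set
_≗T_ {n} S T = ∀ p → S p ≡ T p

IsTiling : ∀ {n} → TileSet n → Set
IsTiling {n} T =
  (i : Fin n) (j : Fin 4) →
    (Σ (Placement n) λ p → (T p ≡ true) × Covers p i j)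
    × (∀ (p q : Placement n) → T p ≡ true → T q ≡ true → Covers p i j → Covers q i j → p ≡ q)

-- The tile p (occupying columns x and x+1, i.e. [x, x+2] horizontally)
-- lies entirely in x ≤ k, or entirely in x ≥ k.
OnOneSide : ∀ n → ℕ → Placement n → Set
OnOneSide n k (x , _ , _) = (toℕ x + 2 ≤ k) ⊎ (k ≤ toℕ x)

FaultFree : ∀ {n} → TileSet n → Set
FaultFree {n} T =
  ¬ (Σ ℕ λ k → (0 < k) × (k < n) × (∀ p → T p ≡ true → OnOneSide n k p))

FaultFreeTiling : ∀ {n} → TileSet n → Set
FaultFreeTiling {n} T = IsTiling {n} T × FaultFree {n} T

NumFaultFree : ℕ → ℕ → Set
NumFaultFree n c =
  Σ (List (TileSet n)) λ L →
    (length L ≡ c)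
    × All (FaultFreeTiling {n}) L
    × AllPairs (λ S T → ¬ (_≗T_ {n} S T)) L
    × (∀ (T : TileSet n) → FaultFreeTiling {n} T → Any (λ S → _≗T_ {n} S T) L)

N′≡ : ℕ → ℕ → Set
N′≡ t c = NumFaultFree (3 * t) c

-- Record, for every column of the 4 × n rectangle, the tiles whose left half lies in it. A tiling
-- becomes a word of such columns in which consecutive columns fit: every cell of the column they
-- share is covered exactly once. A fault at k means exactly that column k − 1 is empty, and a
-- nonempty column fitting between two others covers no cell twice; only 32 columns have both
-- properties. So the fault-free tilings of the 4 × (m + 1) rectangle are the walks of length m
-- through a 32-state automaton, starting and ending next to an empty column. By evaluation, from
-- every state there are six times as many walks of length 8 as of length 5; as walks of length
-- k + 1 from a state are counted by summing over its successors, the ratio 6 between lengths k + 3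
-- and k persists for all k ≥ 5.

module Submission where

open import Defs
open import Data.Bool using (Bool; true; false)
import Data.Bool.Properties as Bool
open import Data.Empty using (⊥-elim)
open import Data.Fin using (Fin; zero; suc; toℕ; fromℕ<; #_)
open import Data.Fin.Patterns using (0F; 1F; 2F)
import Data.Fin.Properties as Fin
open import Data.Fin.Subset.Properties using (anySubset?)
open import Data.List using (List; []; _∷_; [_]; _++_; length; map; filter; allFin; concatMap)
import Data.List.Properties as List
open import Data.List.Membership.Propositional using (_∈_; lose; find)
open import Data.List.Membership.Propositional.Properties
  using (∈-filter⁺; ∈-filter⁻; ∈-map⁺; ∈-map⁻; ∈-++⁺ˡ; ∈-++⁺ʳ; ∈-allFin; ∈-concatMap⁺; ∈-concatMap⁻)
import Data.List.Membership.DecPropositional as DecMembership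
open import Data.List.Relation.Binary.Disjoint.Propositional using (Disjoint)
open import Data.List.Relation.Unary.All using ([]; _∷_)
import Data.List.Relation.Unary.All as All
import Data.List.Relation.Unary.All.Properties as All
open import Data.List.Relation.Unary.AllPairs using ([]; _∷_)
import Data.List.Relation.Unary.AllPairs as AllPairs
import Data.List.Relation.Unary.AllPairs.Properties as AllPairs
open import Data.List.Relation.Unary.Any using (here; there; any?; satisfied)
import Data.List.Relation.Unary.Any.Properties as Any
open import Data.List.Relation.Unary.Unique.Propositional using (Unique)
import Data.List.Relation.Unary.Unique.Propositional.Properties as Unique
open import Data.Maybe using (Maybe; nothing; just)
open import Data.Nat using (ℕ; zero; suc; _+_; _*_; _^_; _∸_; _≤_; _<_; z≤n; s≤s; s≤s⁻¹)
import Data.Nat.Properties as ℕ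
open import Data.Nat.ListAction using (sum)
open import Data.Product using (Σ; ∃; _×_; _,_; proj₁; proj₂)
open import Data.Product.Function.NonDependent.Propositional using (_×-↔_)
open import Data.Product.Properties using (≡-dec)
open import Data.Sum using (_⊎_; inj₁; inj₂; [_,_]′)
import Data.Sum.Properties as Sum
open import Data.Vec using (Vec; []; _∷_; lookup; tabulate)
import Data.Vec.Properties as Vec
open import Function using (_∘_; _$_)
open import Function.Bundles using (Inverse; Injection; _↔_; _⇔_; mk⇔; Equivalence)
open import Function.Properties.Inverse using (↔-refl; ↔-trans; ↔⇒↣)
open import Relation.Binary.Definitions using (tri<; tri≈; tri>)
open import Relation.Binary.PropositionalEquality hiding ([_])
open import Relation.Nullary using (Dec; yes; no; does; ¬_; ¬?; contradiction)
open import Relation.Nullary.Decidable using (map′; _×-dec_; _→-dec_; from-yes; from-no)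
open import Relation.Unary using (Pred; Decidable)

module _ {a p} {A : Set a} {P : Pred A p} (P? : Decidable P) where

  length-filter-map : ∀ {b} {B : Set b} (f : B → A) xs →
                      length (filter P? (map f xs)) ≡ length (filter (P? ∘ f) xs)
  length-filter-map f [] = refl
  length-filter-map f (x ∷ xs) with P? (f x)
  ... | yes _ = cong suc (length-filter-map f xs)
  ... | no _ = length-filter-map f xs

  private
    length≡1 : ∀ {x} {ys : List A} → Unique ys → x ∈ ys → (∀ {y} → y ∈ ys → y ≡ x) → length ys ≡ 1
    length≡1 {ys = _ ∷ []} _ _ _ = refl
    length≡1 {ys = _ ∷ _ ∷ _} ((y≢z ∷ _) ∷ _) _ ≡x =
      contradiction (trans (≡x (here refl)) (sym (≡x (there (here refl))))) y≢z

  length-filter≡1 : ∀ {x xs} → Unique xs → x ∈ xs → P x → (∀ {y} → y ∈ xs → P y → y ≡ x) →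
                    length (filter P? xs) ≡ 1
  length-filter≡1 uniq x∈xs Px ≡x =
    length≡1 (Unique.filter⁺ P? uniq) (∈-filter⁺ P? x∈xs Px)
      (λ y∈ → let y∈xs , Py = ∈-filter⁻ P? y∈ in ≡x y∈xs Py)

  length-filter≡1⁻ : ∀ {xs} → length (filter P? xs) ≡ 1 →
                     ∃ λ x → x ∈ xs × P x × (∀ {y} → y ∈ xs → P y → y ≡ x)
  length-filter≡1⁻ {xs} _ with filter P? xs in eq
  ... | x ∷ [] = let x∈xs , Px = ∈-filter⁻ P? {xs = xs} x∈ in x , x∈xs , Px , ≡x
    where
    x∈ : x ∈ filter P? xs
    x∈ = subst (x ∈_) (sym eq) (here refl)
    ≡x : ∀ {y} → y ∈ xs → P y → y ≡ x
    ≡x y∈ Py with subst (_ ∈_) eq (∈-filter⁺ P? y∈ Py)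
    ... | here y≡x = y≡x

length-concatMap : ∀ {a b} {A : Set a} {B : Set b} (f : A → List B) xs →
                   length (concatMap f xs) ≡ sum (map (length ∘ f) xs)
length-concatMap f [] = refl
length-concatMap f (x ∷ xs) =
  trans (List.length-++ (f x)) (cong (length (f x) +_) (length-concatMap f xs))

sum-map-*ˡ : ∀ {a} {A : Set a} c (f : A → ℕ) xs →
             sum (map (λ x → c * f x) xs) ≡ c * sum (map f xs)
sum-map-*ˡ c f [] = sym (ℕ.*-zeroʳ c)
sum-map-*ˡ c f (x ∷ xs) =
  trans (cong (c * f x +_) (sum-map-*ˡ c f xs)) (sym (ℕ.*-distribˡ-+ c (f x) _))

Tromino : Set
Tromino = Fin 3 × Fin 2 × Fin 2

tromino↔ : Fin 12 ↔ Tromino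
tromino↔ = ↔-trans (Fin.*↔× {3} {4}) (↔-refl ×-↔ Fin.*↔× {2} {2})

open Inverse tromino↔ using () renaming (to to tromino; from to trominoIndex)

trominoes : List Tromino
trominoes = map tromino (allFin 12)

∈-trominoes : ∀ q → q ∈ trominoes
∈-trominoes q =
  subst (_∈ trominoes) (Inverse.strictlyInverseˡ tromino↔ q) (∈-map⁺ tromino (∈-allFin (trominoIndex q)))

trominoes-unique : Unique trominoes
trominoes-unique = Unique.map⁺ (Injection.injective (↔⇒↣ tromino↔)) (Unique.allFin⁺ 12)

-- A column of a tiling: its tiles whose left half lies in that column.
Column : Set
Column = Tromino → Bool

-- Columns as bit vectors, so that all of them can be enumerated as subsets of Fin 12.
Code : Set
Code = Vec Bool 12

decode : Code → Column
decode v = lookup v ∘ trominoIndex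

encode : Column → Code
encode A = tabulate (A ∘ tromino)

decode-encode : ∀ A q → decode (encode A) q ≡ A q
decode-encode A q =
  trans (Vec.lookup∘tabulate (A ∘ tromino) (trominoIndex q)) (cong A (Inverse.strictlyInverseˡ tromino↔ q))

-- d = 0F is the left and d = 1F the right column of the tromino's 2 × 2 block.
CoversAt : Tromino → Fin 2 → Fin 4 → Set
CoversAt (y , miss) d j = ∃ λ dy → toℕ j ≡ toℕ y + toℕ dy × miss ≢ (d , dy)

coversAt? : ∀ q d j → Dec (CoversAt q d j)
coversAt? (y , miss) d j =
  Fin.any? λ dy → (toℕ j ℕ.≟ toℕ y + toℕ dy) ×-dec ¬? (≡-dec Fin._≟_ Fin._≟_ miss (d , dy))

Covering : Column → Fin 2 → Fin 4 → Pred Tromino _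
Covering A d j q = A q ≡ true × CoversAt q d j

covering? : ∀ A d j → Decidable (Covering A d j)
covering? A d j q = (A q Bool.≟ true) ×-dec coversAt? q d j

coverage : Fin 2 → Column → Fin 4 → ℕ
coverage d A j = length (filter (covering? A d j) trominoes)

coverage-cong : ∀ {A B} d j → (∀ q → A q ≡ B q) → coverage d A j ≡ coverage d B j
coverage-cong {A} {B} d j A≗B = cong length (List.filter-≐ (covering? A d j) (covering? B d j)
  ((λ (Aq , c) → trans (sym (A≗B _)) Aq , c) , (λ (Bq , c) → trans (A≗B _) Bq , c)) trominoes)

Fits : Column → Column → Set
Fits A B = ∀ j → coverage 1F A j + coverage 0F B j ≡ 1

fits? : ∀ A B → Dec (Fits A B)
fits? A B = Fin.all? λ j → coverage 1F A j + coverage 0F B j ℕ.≟ 1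

Fits-cong : ∀ {A A′ B B′} → (∀ q → A q ≡ A′ q) → (∀ q → B q ≡ B′ q) → Fits A B → Fits A′ B′
Fits-cong A≗A′ B≗B′ fits j =
  trans (cong₂ _+_ (sym (coverage-cong 1F j A≗A′)) (sym (coverage-cong 0F j B≗B′))) (fits j)

Fits⇒coverageʳ≤1 : ∀ {A B} → Fits A B → ∀ j → coverage 1F A j ≤ 1
Fits⇒coverageʳ≤1 {A} {B} fits j = subst (coverage 1F A j ≤_) (fits j) (ℕ.m≤m+n _ _)

Fits⇒coverageˡ≤1 : ∀ {A B} → Fits A B → ∀ j → coverage 0F B j ≤ 1
Fits⇒coverageˡ≤1 {A} {B} fits j = subst (coverage 0F B j ≤_) (fits j) (ℕ.m≤n+m _ _)

column : ∀ {m} → TileSet (suc m) → ℕ → Column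
column {m} S k q with k ℕ.<? m
... | yes k<m = S (fromℕ< k<m , q)
... | no _ = false

column-in : ∀ {m} (S : TileSet (suc m)) {k} (k<m : k < m) q → column S k q ≡ S (fromℕ< k<m , q)
column-in {m} S {k} k<m q with k ℕ.<? m
... | yes _ = refl
... | no k≮m = contradiction k<m k≮m

column-out : ∀ {m} (S : TileSet (suc m)) {k} → m ≤ k → ∀ q → column S k q ≡ false
column-out {m} S {k} m≤k q with k ℕ.<? m
... | yes k<m = contradiction m≤k (ℕ.<⇒≱ k<m)
... | no _ = refl

column-toℕ : ∀ {m} (S : TileSet (suc m)) x q → column S (toℕ x) q ≡ S (x , q)
column-toℕ S x q = trans (column-in S (Fin.toℕ<n x) q) (cong (λ x → S (x , q)) (Fin.fromℕ<-toℕ x _))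

column≡true : ∀ {m} (S : TileSet (suc m)) {k q} → column S k q ≡ true →
              ∃ λ x → toℕ x ≡ k × S (x , q) ≡ true
column≡true {m} S {k} {q} Sq with k ℕ.<? m
... | yes k<m = fromℕ< k<m , Fin.toℕ-fromℕ< k<m , Sq

column-cong : ∀ {m} {S S′ : TileSet (suc m)} → _≗T_ {suc m} S S′ →
              ∀ k q → column S k q ≡ column S′ k q
column-cong {m} S≗S′ k q with k ℕ.<? m
... | yes k<m = S≗S′ (fromℕ< k<m , q)
... | no _ = refl

∅ : Column
∅ _ = false

-- padded S c: the tiles of S whose right half lies in column c.
padded : ∀ {m} → TileSet (suc m) → ℕ → Column
padded S zero = ∅
padded S (suc k) = column S k

padded-cong : ∀ {m} {S S′ : TileSet (suc m)} → _≗T_ {suc m} S S′ →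
              ∀ c q → padded S c q ≡ padded S′ c q
padded-cong S≗S′ zero q = refl
padded-cong S≗S′ (suc k) q = column-cong S≗S′ k q

padded≡true : ∀ {m} (S : TileSet (suc m)) {c q} → padded S c q ≡ true →
              ∃ λ x → suc (toℕ x) ≡ c × S (x , q) ≡ true
padded≡true S {suc k} Sq = let x , x≡k , Sp = column≡true S Sq in x , cong suc x≡k , Sp

candidates : List (Tromino ⊎ Tromino)
candidates = map inj₁ trominoes ++ map inj₂ trominoes

∈-candidates : ∀ a → a ∈ candidates
∈-candidates (inj₁ q) = ∈-++⁺ˡ (∈-map⁺ inj₁ (∈-trominoes q))
∈-candidates (inj₂ q) = ∈-++⁺ʳ (map inj₁ trominoes) (∈-map⁺ inj₂ (∈-trominoes q))

candidates-unique : Unique candidates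
candidates-unique = Unique.++⁺ (Unique.map⁺ Sum.inj₁-injective trominoes-unique)
                               (Unique.map⁺ Sum.inj₂-injective trominoes-unique) disjoint
  where
  disjoint : Disjoint (map inj₁ trominoes) (map inj₂ trominoes)
  disjoint (a∈ , b∈) with ∈-map⁻ inj₁ a∈ | ∈-map⁻ inj₂ b∈
  ... | _ , _ , refl | _ , _ , ()

CoveredOnce : ∀ {n} → TileSet n → Fin n → Fin 4 → Set
CoveredOnce {n} S i j =
  (Σ (Placement n) λ p → (S p ≡ true) × Covers p i j)
  × (∀ (p q : Placement n) → S p ≡ true → S q ≡ true → Covers p i j → Covers q i j → p ≡ q)

-- A tile covering the cell (i , j) has its left half in column i (inj₂) or its right half there (inj₁).
module _ {m} (S : TileSet (suc m)) (i : Fin (suc m)) (j : Fin 4) where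

  Candidate : Pred (Tromino ⊎ Tromino) _
  Candidate (inj₁ q) = Covering (padded S (toℕ i)) 1F j q
  Candidate (inj₂ q) = Covering (padded S (suc (toℕ i))) 0F j q

  candidate? : Decidable Candidate
  candidate? (inj₁ q) = covering? (padded S (toℕ i)) 1F j q
  candidate? (inj₂ q) = covering? (padded S (suc (toℕ i))) 0F j q

  toCandidate : (p : Placement (suc m)) → Covers p i j → Tromino ⊎ Tromino
  toCandidate (_ , q) (0F , _) = inj₂ q
  toCandidate (_ , q) (1F , _) = inj₁ q

  toCandidate-cong : ∀ {p p′} → p ≡ p′ → (c : Covers p i j) (c′ : Covers p′ i j) →
                     toCandidate p c ≡ toCandidate p′ c′
  toCandidate-cong refl (0F , _) (0F , _) = refl
  toCandidate-cong refl (1F , _) (1F , _) = refl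
  toCandidate-cong {x , _} refl (0F , _ , i≡x+0 , _) (1F , _ , i≡x+1 , _) =
    contradiction (ℕ.+-cancelˡ-≡ (toℕ x) 0 1 (trans (sym i≡x+0) i≡x+1)) λ ()
  toCandidate-cong {x , _} refl (1F , _ , i≡x+1 , _) (0F , _ , i≡x+0 , _) =
    contradiction (ℕ.+-cancelˡ-≡ (toℕ x) 0 1 (trans (sym i≡x+0) i≡x+1)) λ ()

  toCandidate-injective : ∀ p p′ (c : Covers p i j) (c′ : Covers p′ i j) →
                          toCandidate p c ≡ toCandidate p′ c′ → p ≡ p′
  toCandidate-injective (x , q) (x′ , .q) (0F , _ , i≡x+0 , _) (0F , _ , i≡x′+0 , _) refl =
    cong (_, q) (Fin.toℕ-injective (ℕ.+-cancelʳ-≡ 0 (toℕ x) (toℕ x′) (trans (sym i≡x+0) i≡x′+0)))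
  toCandidate-injective (x , q) (x′ , .q) (1F , _ , i≡x+1 , _) (1F , _ , i≡x′+1 , _) refl =
    cong (_, q) (Fin.toℕ-injective (ℕ.+-cancelʳ-≡ 1 (toℕ x) (toℕ x′) (trans (sym i≡x+1) i≡x′+1)))
  toCandidate-injective _ _ (0F , _) (1F , _) ()
  toCandidate-injective _ _ (1F , _) (0F , _) ()

  candidate-toCandidate : ∀ p → S p ≡ true → (c : Covers p i j) → Candidate (toCandidate p c)
  candidate-toCandidate (x , q@(_ , _)) Sp (0F , dy , i≡x+0 , covers) =
    subst (λ k → column S k q ≡ true) (sym (trans i≡x+0 (ℕ.+-identityʳ (toℕ x)))) (trans (column-toℕ S x q) Sp) ,
    dy , covers
  candidate-toCandidate (x , q@(_ , _)) Sp (1F , dy , i≡x+1 , covers) =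
    subst (λ k → padded S k q ≡ true) (sym (trans i≡x+1 (ℕ.+-comm (toℕ x) 1))) (trans (column-toℕ S x q) Sp) ,
    dy , covers

  fromCandidate : ∀ a → Candidate a → ∃ λ p → S p ≡ true × Σ (Covers p i j) λ c → toCandidate p c ≡ a
  fromCandidate (inj₂ q@(_ , _)) (Sq , dy , covers) =
    let x , x≡i , Sp = column≡true S Sq
    in  (x , q) , Sp , (0F , dy , trans (sym x≡i) (sym (ℕ.+-identityʳ (toℕ x))) , covers) , refl
  fromCandidate (inj₁ q@(_ , _)) (Sq , dy , covers) =
    let x , x+1≡i , Sp = padded≡true S Sq
    in  (x , q) , Sp , (1F , dy , trans (sym x+1≡i) (ℕ.+-comm 1 (toℕ x)) , covers) , refl

  length-filter-candidates : length (filter candidate? candidates)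
                             ≡ coverage 1F (padded S (toℕ i)) j + coverage 0F (padded S (suc (toℕ i))) j
  length-filter-candidates = begin
    length (filter candidate? (map inj₁ trominoes ++ map inj₂ trominoes))
      ≡⟨ cong length (List.filter-++ candidate? (map inj₁ trominoes) _) ⟩
    length (filter candidate? (map inj₁ trominoes) ++ filter candidate? (map inj₂ trominoes))
      ≡⟨ List.length-++ (filter candidate? (map inj₁ trominoes)) ⟩
    length (filter candidate? (map inj₁ trominoes)) + length (filter candidate? (map inj₂ trominoes))
      ≡⟨ cong₂ _+_ (length-filter-map candidate? inj₁ trominoes)
                   (length-filter-map candidate? inj₂ trominoes) ⟩
    coverage 1F (padded S (toℕ i)) j + coverage 0F (padded S (suc (toℕ i))) j ∎
    where open ≡-Reasoning

  coveredOnce⇔ : CoveredOnce S i j ⇔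
                 (coverage 1F (padded S (toℕ i)) j + coverage 0F (padded S (suc (toℕ i))) j ≡ 1)
  coveredOnce⇔ = subst (CoveredOnce S i j ⇔_) (cong (_≡ 1) length-filter-candidates) (mk⇔ once⇒ ⇒once)
    where
    once⇒ : CoveredOnce S i j → length (filter candidate? candidates) ≡ 1
    once⇒ ((p , Sp , c) , unique) =
      length-filter≡1 candidate? candidates-unique (∈-candidates _) (candidate-toCandidate p Sp c) ≡a
      where
      ≡a : ∀ {b} → b ∈ candidates → Candidate b → b ≡ toCandidate p c
      ≡a {b} _ cb = let p′ , Sp′ , c′ , ≡b = fromCandidate b cb
                    in trans (sym ≡b) (toCandidate-cong (unique p′ p Sp′ Sp c′ c) c′ c)

    ⇒once : length (filter candidate? candidates) ≡ 1 → CoveredOnce S i j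
    ⇒once once with length-filter≡1⁻ candidate? once
    ... | a , _ , ca , ≡a with fromCandidate a ca
    ... | p , Sp , c , _ = (p , Sp , c) , unique
      where
      unique : ∀ p q → S p ≡ true → S q ≡ true → Covers p i j → Covers q i j → p ≡ q
      unique p q Sp Sq cp cq = toCandidate-injective p q cp cq (trans (≡a′ p Sp cp) (sym (≡a′ q Sq cq)))
        where ≡a′ = λ p Sp cp → ≡a (∈-candidates _) (candidate-toCandidate p Sp cp)

isTiling⇔fits : ∀ {m} (S : TileSet (suc m)) →
                IsTiling S ⇔ (∀ c → c ≤ m → Fits (padded S c) (padded S (suc c)))
isTiling⇔fits {m} S = mk⇔ tiling⇒ ⇒tiling
  where
  tiling⇒ : IsTiling S → ∀ c → c ≤ m → Fits (padded S c) (padded S (suc c))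
  tiling⇒ tiling c c≤m j =
    subst (λ c → coverage 1F (padded S c) j + coverage 0F (padded S (suc c)) j ≡ 1)
      (Fin.toℕ-fromℕ< (s≤s c≤m)) (Equivalence.to (coveredOnce⇔ S _ j) (tiling (fromℕ< (s≤s c≤m)) j))
  ⇒tiling : (∀ c → c ≤ m → Fits (padded S c) (padded S (suc c))) → IsTiling S
  ⇒tiling fits i j = Equivalence.from (coveredOnce⇔ S i j) (fits (toℕ i) (s≤s⁻¹ (Fin.toℕ<n i)) j)

Nonempty : Column → Set
Nonempty A = ∃ λ q → A q ≡ true

nonempty? : ∀ A → Dec (Nonempty A)
nonempty? A =
  map′ satisfied (λ (q , Aq) → lose (∈-trominoes q) Aq) (any? (λ q → A q Bool.≟ true) trominoes)

faultFree⇔nonempty : ∀ {m} (S : TileSet (suc m)) →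
                     FaultFree S ⇔ (∀ k → k < m → Nonempty (column S k))
faultFree⇔nonempty {m} S = mk⇔ faultFree⇒ ⇒faultFree
  where
  faultFree⇒ : FaultFree S → ∀ k → k < m → Nonempty (column S k)
  faultFree⇒ faultFree k k<m with nonempty? (column S k)
  ... | yes nonempty = nonempty
  ... | no empty = ⊥-elim (faultFree (suc k , s≤s z≤n , s≤s k<m , onOneSide))
    where
    onOneSide : ∀ p → S p ≡ true → OnOneSide (suc m) (suc k) p
    onOneSide (x , q) Sp with ℕ.<-cmp (toℕ x) k
    ... | tri< x<k _ _ = inj₁ (subst (_≤ suc k) (ℕ.+-comm 2 (toℕ x)) (s≤s x<k))
    ... | tri≈ _ x≡k _ =
      contradiction (q , subst (λ k → column S k q ≡ true) x≡k (trans (column-toℕ S x q) Sp)) empty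
    ... | tri> _ _ k<x = inj₂ k<x
  ⇒faultFree : (∀ k → k < m → Nonempty (column S k)) → FaultFree S
  ⇒faultFree nonempty (suc k , _ , k+1<n , onOneSide) with nonempty k (s≤s⁻¹ k+1<n)
  ... | q , Sq with column≡true S Sq
  ... | x , refl , Sp with onOneSide (x , q) Sp
  ... | inj₁ x+2≤x+1 = ℕ.<-irrefl refl (subst (_≤ suc (toℕ x)) (ℕ.+-comm (toℕ x) 2) x+2≤x+1)
  ... | inj₂ x+1≤x = ℕ.<-irrefl refl x+1≤x

_≟ᵗ_ : (q q′ : Tromino) → Dec (q ≡ q′)
_≟ᵗ_ = ≡-dec Fin._≟_ (≡-dec Fin._≟_ Fin._≟_)

open DecMembership _≟ᵗ_ using (_∈?_)

-- The nonempty columns covering no cell twice; no-admissible-code-outside-letters shows there are no others.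
letterTrominoes : Vec (List Tromino) 32
letterTrominoes =
  ((2F , 1F , 1F) ∷ []) ∷
  ((2F , 1F , 0F) ∷ []) ∷
  ((2F , 0F , 1F) ∷ []) ∷
  ((2F , 0F , 0F) ∷ []) ∷
  ((1F , 1F , 1F) ∷ []) ∷
  ((1F , 1F , 1F) ∷ (2F , 0F , 0F) ∷ []) ∷
  ((1F , 1F , 0F) ∷ []) ∷
  ((1F , 0F , 1F) ∷ []) ∷
  ((1F , 0F , 1F) ∷ (2F , 1F , 0F) ∷ []) ∷
  ((1F , 0F , 0F) ∷ []) ∷
  ((0F , 1F , 1F) ∷ []) ∷
  ((0F , 1F , 1F) ∷ (2F , 1F , 1F) ∷ []) ∷
  ((0F , 1F , 1F) ∷ (2F , 1F , 0F) ∷ []) ∷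
  ((0F , 1F , 1F) ∷ (2F , 0F , 1F) ∷ []) ∷
  ((0F , 1F , 1F) ∷ (2F , 0F , 0F) ∷ []) ∷
  ((0F , 1F , 1F) ∷ (1F , 0F , 0F) ∷ []) ∷
  ((0F , 1F , 0F) ∷ []) ∷
  ((0F , 1F , 0F) ∷ (2F , 1F , 1F) ∷ []) ∷
  ((0F , 1F , 0F) ∷ (2F , 1F , 0F) ∷ []) ∷
  ((0F , 1F , 0F) ∷ (2F , 0F , 1F) ∷ []) ∷
  ((0F , 1F , 0F) ∷ (2F , 0F , 0F) ∷ []) ∷
  ((0F , 0F , 1F) ∷ []) ∷
  ((0F , 0F , 1F) ∷ (2F , 1F , 1F) ∷ []) ∷
  ((0F , 0F , 1F) ∷ (2F , 1F , 0F) ∷ []) ∷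
  ((0F , 0F , 1F) ∷ (2F , 0F , 1F) ∷ []) ∷
  ((0F , 0F , 1F) ∷ (2F , 0F , 0F) ∷ []) ∷
  ((0F , 0F , 1F) ∷ (1F , 1F , 0F) ∷ []) ∷
  ((0F , 0F , 0F) ∷ []) ∷
  ((0F , 0F , 0F) ∷ (2F , 1F , 1F) ∷ []) ∷
  ((0F , 0F , 0F) ∷ (2F , 1F , 0F) ∷ []) ∷
  ((0F , 0F , 0F) ∷ (2F , 0F , 1F) ∷ []) ∷
  ((0F , 0F , 0F) ∷ (2F , 0F , 0F) ∷ []) ∷
  []

letter : Fin 32 → Column
letter i q = does (q ∈? lookup letterTrominoes i)

letter-nonempty : ∀ i → Nonempty (letter i)
letter-nonempty = from-yes (Fin.all? λ i → nonempty? (letter i))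

letter-injective : ∀ {i i′} → (∀ q → letter i q ≡ letter i′ q) → i ≡ i′
letter-injective {i} {i′} i≗i′ = encode∘letter-injective i i′ (Vec.tabulate-cong (i≗i′ ∘ tromino))
  where
  encode∘letter-injective : ∀ i i′ → encode (letter i) ≡ encode (letter i′) → i ≡ i′
  encode∘letter-injective = from-yes (Fin.all? λ i → Fin.all? λ i′ →
    Vec.≡-dec Bool._≟_ (encode (letter i)) (encode (letter i′)) →-dec i Fin.≟ i′)

Admissible : Column → Set
Admissible A = Nonempty A × (∀ d j → coverage d A j ≤ 1)

Admissible-cong : ∀ {A B} → (∀ q → A q ≡ B q) → Admissible A → Admissible B
Admissible-cong A≗B ((q , Aq) , coverage≤1) =
  (q , trans (sym (A≗B q)) Aq) , λ d j → subst (_≤ 1) (coverage-cong d j A≗B) (coverage≤1 d j)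

admissible? : ∀ A → Dec (Admissible A)
admissible? A = nonempty? A ×-dec Fin.all? λ d → Fin.all? λ j → coverage d A j ℕ.≤? 1

no-admissible-code-outside-letters : ¬ ∃ λ v → Admissible (decode v) × ¬ ∃ λ i → encode (letter i) ≡ v
no-admissible-code-outside-letters = from-no (anySubset? λ v →
  admissible? (decode v) ×-dec ¬? (Fin.any? λ i → Vec.≡-dec Bool._≟_ (encode (letter i)) v))

admissible⇒letter : ∀ {A} → Admissible A → ∃ λ i → ∀ q → letter i q ≡ A q
admissible⇒letter {A} admissible =
  fromDec (Fin.any? λ i → Vec.≡-dec Bool._≟_ (encode (letter i)) (encode A))
  where
  fromDec : Dec (∃ λ i → encode (letter i) ≡ encode A) → ∃ λ i → ∀ q → letter i q ≡ A q
  fromDec (yes (i , i≡A)) = i , λ q → begin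
    letter i q                   ≡⟨ decode-encode (letter i) q ⟨
    decode (encode (letter i)) q ≡⟨ cong (λ v → decode v q) i≡A ⟩
    decode (encode A) q          ≡⟨ decode-encode A q ⟩
    A q                          ∎
    where open ≡-Reasoning
  fromDec (no ∄i) = contradiction
    (encode A , Admissible-cong (λ q → sym (decode-encode A q)) admissible , ∄i)
    no-admissible-code-outside-letters

State : Set
State = Maybe (Fin 32)

stateColumn : State → Column
stateColumn nothing = ∅
stateColumn (just i) = letter i

-- Certified by successors-filter; tabulating it keeps the evaluation of walks free of fits? tests.
successorTable : Vec (List (Fin 32)) 32
successorTable =
  (# 14 ∷ # 20 ∷ []) ∷
  (# 13 ∷ # 15 ∷ # 19 ∷ # 26 ∷ []) ∷
  (# 10 ∷ # 16 ∷ []) ∷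
  (# 10 ∷ # 16 ∷ []) ∷
  (# 22 ∷ # 23 ∷ []) ∷
  (# 21 ∷ []) ∷
  (# 14 ∷ # 20 ∷ []) ∷
  (# 25 ∷ []) ∷
  (# 21 ∷ []) ∷
  (# 25 ∷ []) ∷
  (# 5 ∷ # 8 ∷ # 28 ∷ # 29 ∷ []) ∷
  (# 31 ∷ []) ∷
  (# 4 ∷ # 6 ∷ # 30 ∷ []) ∷
  (# 7 ∷ # 27 ∷ []) ∷
  (# 7 ∷ # 27 ∷ []) ∷
  (# 3 ∷ []) ∷
  (# 22 ∷ # 23 ∷ []) ∷
  (# 25 ∷ []) ∷
  (# 24 ∷ []) ∷
  (# 21 ∷ []) ∷
  (# 21 ∷ []) ∷
  (# 0 ∷ # 1 ∷ []) ∷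
  (# 3 ∷ []) ∷
  (# 2 ∷ # 9 ∷ []) ∷
  [] ∷
  [] ∷
  (# 3 ∷ []) ∷
  (# 0 ∷ # 1 ∷ []) ∷
  (# 3 ∷ []) ∷
  (# 2 ∷ # 9 ∷ []) ∷
  [] ∷
  [] ∷
  []

successors : State → List (Fin 32)
successors nothing = # 11 ∷ # 12 ∷ # 17 ∷ # 18 ∷ []
successors (just i) = lookup successorTable i

successors-filter : ∀ s → successors s ≡ filter (fits? (stateColumn s) ∘ letter) (allFin 32)
successors-filter nothing =
  from-yes (List.≡-dec Fin._≟_ (successors nothing) (filter (fits? ∅ ∘ letter) (allFin 32)))
successors-filter (just i) = from-yes (Fin.all? λ i →
  List.≡-dec Fin._≟_ (successors (just i)) (filter (fits? (letter i) ∘ letter) (allFin 32))) i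

∈-successors : ∀ s i → i ∈ successors s ⇔ Fits (stateColumn s) (letter i)
∈-successors s i = mk⇔
  (λ i∈ → proj₂ (∈-filter⁻ (fits? (stateColumn s) ∘ letter) (subst (i ∈_) (successors-filter s) i∈)))
  (λ fits → subst (i ∈_) (sym (successors-filter s))
              (∈-filter⁺ (fits? (stateColumn s) ∘ letter) (∈-allFin i) fits))

successors-unique : ∀ s → Unique (successors s)
successors-unique s =
  subst Unique (sym (successors-filter s)) (Unique.filter⁺ (fits? (stateColumn s) ∘ letter) (Unique.allFin⁺ 32))

Walk : State → ∀ {k} → Vec (Fin 32) k → Set
Walk s [] = Fits (stateColumn s) ∅
Walk s (i ∷ w) = Fits (stateColumn s) (letter i) × Walk (just i) w

walks : ∀ k → State → List (Vec (Fin 32) k)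
walks zero s with fits? (stateColumn s) ∅
... | yes _ = [ [] ]
... | no _ = []
walks (suc k) s = concatMap (λ i → map (i ∷_) (walks k (just i))) (successors s)

∈-walks : ∀ {k} s (w : Vec (Fin 32) k) → w ∈ walks k s ⇔ Walk s w
∈-walks s [] with fits? (stateColumn s) ∅
... | yes fits = mk⇔ (λ _ → fits) (λ _ → here refl)
... | no ¬fits = mk⇔ (λ ()) (λ fits → contradiction fits ¬fits)
∈-walks {suc k} s (i ∷ w) = mk⇔ walk⇒ ⇒walk
  where
  extend : Fin 32 → List (Vec (Fin 32) (suc k))
  extend i = map (i ∷_) (walks k (just i))
  walk⇒ : i ∷ w ∈ walks (suc k) s → Walk s (i ∷ w)
  walk⇒ i∷w∈ with find (∈-concatMap⁻ extend {xs = successors s} i∷w∈)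
  ... | i , i∈ , i∷w∈′ with ∈-map⁻ (i ∷_) i∷w∈′
  ... | w , w∈ , refl = Equivalence.to (∈-successors s i) i∈ , Equivalence.to (∈-walks (just i) w) w∈
  ⇒walk : Walk s (i ∷ w) → i ∷ w ∈ walks (suc k) s
  ⇒walk (fits , walk) = ∈-concatMap⁺ extend (lose (Equivalence.from (∈-successors s i) fits)
                                                  (∈-map⁺ (i ∷_) (Equivalence.from (∈-walks (just i) w) walk)))

walks-unique : ∀ k s → Unique (walks k s)
walks-unique zero s with fits? (stateColumn s) ∅
... | yes _ = [] ∷ []
... | no _ = []
walks-unique (suc k) s = Unique.concat⁺
  (All.map⁺ (All.tabulate λ {i} _ → Unique.map⁺ Vec.∷-injectiveʳ (walks-unique k (just i))))
  (AllPairs.map⁺ (AllPairs.map disjoint (successors-unique s)))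
  where
  disjoint : ∀ {i i′} → i ≢ i′ →
             Disjoint (map (i ∷_) (walks k (just i))) (map (i′ ∷_) (walks k (just i′)))
  disjoint i≢i′ (v∈ , v∈′) with ∈-map⁻ _ v∈ | ∈-map⁻ _ v∈′
  ... | _ , _ , refl | _ , _ , eq = i≢i′ (Vec.∷-injectiveˡ eq)

columns : State → ∀ {k} → Vec (Fin 32) k → ℕ → Column
columns s w zero = stateColumn s
columns s [] (suc c) = ∅
columns s (i ∷ w) (suc c) = columns (just i) w c

walk⇔fits : ∀ s {k} (w : Vec (Fin 32) k) →
            Walk s w ⇔ (∀ c → c ≤ k → Fits (columns s w c) (columns s w (suc c)))
walk⇔fits s [] = mk⇔ (λ { fits zero _ → fits }) (λ fits → fits zero z≤n)
walk⇔fits s (i ∷ w) = mk⇔ walk⇒ ⇒walk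
  where
  FitsUpTo : ℕ → Set
  FitsUpTo k = ∀ c → c ≤ k → Fits (columns s (i ∷ w) c) (columns s (i ∷ w) (suc c))
  walk⇒ : Walk s (i ∷ w) → FitsUpTo (suc _)
  walk⇒ (fits , _) zero _ = fits
  walk⇒ (_ , walk) (suc c) (s≤s c≤k) = Equivalence.to (walk⇔fits (just i) w) walk c c≤k
  ⇒walk : FitsUpTo (suc _) → Walk s (i ∷ w)
  ⇒walk fits = fits zero z≤n , Equivalence.from (walk⇔fits (just i) w) (λ c c≤k → fits (suc c) (s≤s c≤k))

columns-lookup : ∀ s {k} (w : Vec (Fin 32) k) x → columns s w (suc (toℕ x)) ≡ letter (lookup w x)
columns-lookup s (i ∷ w) zero = refl
columns-lookup s (i ∷ w) (suc x) = columns-lookup (just i) w x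

columns-beyond : ∀ s {k} (w : Vec (Fin 32) k) {c} → k ≤ c → columns s w (suc c) ≡ ∅
columns-beyond s [] _ = refl
columns-beyond s (i ∷ w) (s≤s k≤c) = columns-beyond (just i) w k≤c

tiling : ∀ {m} → Vec (Fin 32) m → TileSet (suc m)
tiling w (x , q) = letter (lookup w x) q

padded-tiling : ∀ {m} (w : Vec (Fin 32) m) c q → padded (tiling w) c q ≡ columns nothing w c q
padded-tiling w zero q = refl
padded-tiling {m} w (suc k) q = [ inRange , beyond ]′ (ℕ.<-≤-connex k m)
  where
  inRange : k < m → column (tiling w) k q ≡ columns nothing w (suc k) q
  inRange k<m = begin
    column (tiling w) k q                        ≡⟨ column-in (tiling w) k<m q ⟩
    letter (lookup w (fromℕ< k<m)) q             ≡⟨ cong (_$ q) (columns-lookup nothing w (fromℕ< k<m)) ⟨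
    columns nothing w (suc (toℕ (fromℕ< k<m))) q ≡⟨ cong (λ k → columns nothing w (suc k) q)
                                                          (Fin.toℕ-fromℕ< k<m) ⟩
    columns nothing w (suc k) q                  ∎
    where open ≡-Reasoning
  beyond : m ≤ k → column (tiling w) k q ≡ columns nothing w (suc k) q
  beyond m≤k = trans (column-out (tiling w) m≤k q) (sym (cong (_$ q) (columns-beyond nothing w m≤k)))

tiling-faultFreeTiling : ∀ {m} (w : Vec (Fin 32) m) → Walk nothing w → FaultFreeTiling (tiling w)
tiling-faultFreeTiling {m} w walk =
  Equivalence.from (isTiling⇔fits (tiling w)) fits ,
  Equivalence.from (faultFree⇔nonempty (tiling w)) nonempty
  where
  fits : ∀ c → c ≤ m → Fits (padded (tiling w) c) (padded (tiling w) (suc c))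
  fits c c≤m = Fits-cong (sym ∘ padded-tiling w c) (sym ∘ padded-tiling w (suc c))
                 (Equivalence.to (walk⇔fits nothing w) walk c c≤m)
  nonempty : ∀ k → k < m → Nonempty (column (tiling w) k)
  nonempty k k<m = let q , w∋q = letter-nonempty (lookup w (fromℕ< k<m))
                   in q , trans (column-in (tiling w) k<m q) w∋q

tiling-injective : ∀ {m} {w w′ : Vec (Fin 32) m} → _≗T_ {suc m} (tiling w) (tiling w′) → w ≡ w′
tiling-injective {w = w} {w′} w≗w′ = begin
  w                    ≡⟨ Vec.tabulate∘lookup w ⟨
  tabulate (lookup w)  ≡⟨ Vec.tabulate-cong (λ x → letter-injective (λ q → w≗w′ (x , q))) ⟩
  tabulate (lookup w′) ≡⟨ Vec.tabulate∘lookup w′ ⟩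
  w′                   ∎
  where open ≡-Reasoning

column-admissible : ∀ {m} {S : TileSet (suc m)} → FaultFreeTiling S →
                    ∀ k → k < m → Admissible (column S k)
column-admissible {S = S} (isTiling , faultFree) k k<m =
  Equivalence.to (faultFree⇔nonempty S) faultFree k k<m , λ where
    zero j → Fits⇒coverageˡ≤1 {padded S k} {padded S (suc k)} (fits k (ℕ.<⇒≤ k<m)) j
    (suc zero) j → Fits⇒coverageʳ≤1 {padded S (suc k)} {padded S (suc (suc k))} (fits (suc k) k<m) j
  where
  fits : ∀ c → c ≤ _ → Fits (padded S c) (padded S (suc c))
  fits = Equivalence.to (isTiling⇔fits S) isTiling

tiling-tabulate : ∀ {m} {S : TileSet (suc m)} (f : Fin m → Fin 32) →
                  (∀ x q → letter (f x) q ≡ S (x , q)) → _≗T_ {suc m} (tiling (tabulate f)) S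
tiling-tabulate f f≗S (x , q) = trans (cong (λ i → letter i q) (Vec.lookup∘tabulate f x)) (f≗S x q)

faultFreeTiling⇒walk : ∀ {m} {S : TileSet (suc m)} → FaultFreeTiling S →
                       ∃ λ w → Walk nothing w × _≗T_ {suc m} (tiling w) S
faultFreeTiling⇒walk {m} {S} faultFreeTiling = w , walk , w≗S
  where
  letterAt : ∀ x → ∃ λ i → ∀ q → letter i q ≡ column S (toℕ x) q
  letterAt x = admissible⇒letter (column-admissible faultFreeTiling (toℕ x) (Fin.toℕ<n x))
  w : Vec (Fin 32) m
  w = tabulate (proj₁ ∘ letterAt)
  w≗S : _≗T_ {suc m} (tiling w) S
  w≗S = tiling-tabulate (proj₁ ∘ letterAt) λ x q → trans (proj₂ (letterAt x) q) (column-toℕ S x q)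
  padded≗columns : ∀ c q → padded S c q ≡ columns nothing w c q
  padded≗columns c q = trans (sym (padded-cong w≗S c q)) (padded-tiling w c q)
  walk : Walk nothing w
  walk = Equivalence.from (walk⇔fits nothing w) λ c c≤m →
    Fits-cong (padded≗columns c) (padded≗columns (suc c))
      (Equivalence.to (isTiling⇔fits S) (proj₁ faultFreeTiling) c c≤m)

numFaultFree : ∀ m → NumFaultFree (suc m) (length (walks m nothing))
numFaultFree m =
  map tiling (walks m nothing) , List.length-map tiling (walks m nothing) , faultFree , distinct , complete
  where
  faultFree = All.map⁺ (All.tabulate λ {w} w∈ →
    tiling-faultFreeTiling w (Equivalence.to (∈-walks nothing w) w∈))
  distinct = AllPairs.map⁺ (AllPairs.map (λ w≢w′ w≗w′ → w≢w′ (tiling-injective w≗w′))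
                                         (walks-unique m nothing))
  complete : ∀ S → FaultFreeTiling S → _
  complete S faultFreeTiling = let w , walk , w≗S = faultFreeTiling⇒walk faultFreeTiling
                               in Any.map⁺ (lose (Equivalence.from (∈-walks nothing w) walk) w≗S)

length-walks-suc : ∀ k s →
                   length (walks (suc k) s) ≡ sum (map (λ i → length (walks k (just i))) (successors s))
length-walks-suc k s = trans (length-concatMap _ (successors s))
  (cong sum (List.map-cong (λ i → List.length-map (i ∷_) (walks k (just i))) (successors s)))

walks-scale : ∀ a b → (∀ i → length (walks a (just i)) ≡ 6 * length (walks b (just i))) →
              ∀ s → length (walks (suc a) s) ≡ 6 * length (walks (suc b) s)
walks-scale a b scaled s = begin
  length (walks (suc a) s)                                         ≡⟨ length-walks-suc a s ⟩
  sum (map (λ i → length (walks a (just i))) (successors s))       ≡⟨ cong sum (List.map-cong scaled (successors s)) ⟩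
  sum (map (λ i → 6 * length (walks b (just i))) (successors s))   ≡⟨ sum-map-*ˡ 6 _ (successors s) ⟩
  6 * sum (map (λ i → length (walks b (just i))) (successors s))   ≡⟨ cong (6 *_) (length-walks-suc b s) ⟨
  6 * length (walks (suc b) s)                                     ∎
  where open ≡-Reasoning

-- Not for the empty start state: walks 8 nothing and walks 5 nothing have lengths 8 and 2.
walks-period : ∀ k i → length (walks (8 + k) (just i)) ≡ 6 * length (walks (5 + k) (just i))
walks-period zero =
  from-yes (Fin.all? λ i → length (walks 8 (just i)) ℕ.≟ 6 * length (walks 5 (just i)))
walks-period (suc k) = walks-scale (8 + k) (5 + k) (walks-period k) ∘ just

length-walks-nothing : ∀ t → length (walks (8 + 3 * t) nothing) ≡ 8 * 6 ^ t
length-walks-nothing zero = refl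
length-walks-nothing (suc t) = begin
  length (walks (8 + 3 * suc t) nothing)     ≡⟨ cong (λ n → length (walks (8 + n) nothing)) (ℕ.*-suc 3 t) ⟩
  length (walks (9 + (2 + 3 * t)) nothing)   ≡⟨ walks-scale (10 + 3 * t) (7 + 3 * t)
                                                  (walks-period (2 + 3 * t)) nothing ⟩
  6 * length (walks (8 + 3 * t) nothing)     ≡⟨ cong (6 *_) (length-walks-nothing t) ⟩
  6 * (8 * 6 ^ t)                            ≡⟨ ℕ.*-assoc 6 8 (6 ^ t) ⟨
  48 * 6 ^ t                                 ≡⟨ ℕ.*-assoc 8 6 (6 ^ t) ⟩
  8 * 6 ^ suc t                              ∎
  where open ≡-Reasoning

mainTheorem2 : N′≡ 1 4 × N′≡ 2 2 × ((t : ℕ) → 3 ≤ t → N′≡ t (8 * 6 ^ (t ∸ 3)))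
mainTheorem2 = numFaultFree 2 , numFaultFree 5 , large
  where
  large : (t : ℕ) → 3 ≤ t → N′≡ t (8 * 6 ^ (t ∸ 3))
  large (suc (suc (suc t))) _ =
    subst₂ NumFaultFree (sym (ℕ.*-distribˡ-+ 3 3 t)) (length-walks-nothing t) (numFaultFree (8 + 3 * t))
  large (suc zero) (s≤s ())
  large (suc (suc zero)) (s≤s (s≤s ()))
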